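{- Let $N$ be an unrooted phylogenetic network with exactly four leaves that is not a tree. Then $N$ is forest-based if and only if $N$ has a leaf induced path partition consisting of two paths.
   Context: A leaf of an undirected graph is a vertex of degree $1$; $L(N)$ is the leaf set. An unrooted phylogenetic network is a simple connected undirected graph $N=(V,E)$ with non-empty leaf set and with no vertex of degree $2$. $N$ is forest-based if it contains a spanning forest $F$ with leaf set $L(N)$ such that every edge of $E$ not in $F$ has its ends in different connected components of $F$ (i.e., each tree of $F$ is an induced subgraph of $N$). A leaf induced path partition of $N$ is a partition of $V$ into vertex-disjoint induced paths of $N$ such that every path of length zero is contained in $L(N)$ and every other path meets $L(N)$ exactly in its two end vertices. -}

module Defs where

open import Data.Nat using (ℕ; zero; suc; _+_; _≤_)
open import Data.Bool using (Bool; true; false; if_then_else_)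
open import Data.Fin using (Fin; zero; suc; toℕ; inject₁; fromℕ)
open import Data.Product using (Σ; ∃; ∃-syntax; _×_; _,_)
open import Data.Sum using (_⊎_)
open import Relation.Nullary using (¬_)
open import Relation.Binary.PropositionalEquality using (_≡_; _≢_)
open import Function.Bundles using (_⇔_)
open import Function.Definitions using (Injective)

countTrue : ∀ {n} → (Fin n → Bool) → ℕ
countTrue {zero}  b = 0
countTrue {suc n} b = (if b zero then 1 else 0) + countTrue (λ i → b (suc i))

record Graph : Set where
  field
    n      : ℕ
    adj    : Fin n → Fin n → Bool
    sym    : ∀ u v → adj u v ≡ adj v u
    irrefl : ∀ v → adj v v ≡ false

module _ {n : ℕ} (adj : Fin n → Fin n → Bool) where

  deg : Fin n → ℕ
  deg v = countTrue (adj v)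

  data Walk : Fin n → Fin n → Set where
    here : ∀ {u} → Walk u u
    step : ∀ {u v w} → adj u v ≡ true → Walk v w → Walk u w

  Connected : Set
  Connected = ∀ u v → Walk u v

  -- a cycle of length k+3: injective cyclic sequence of vertices
  -- with consecutive vertices adjacent
  record Cycle : Set where
    field
      k      : ℕ
      c      : Fin (suc (suc (suc k))) → Fin n
      inj    : Injective _≡_ _≡_ c
      cons   : ∀ (i : Fin (suc (suc k))) → adj (c (inject₁ i)) (c (suc i)) ≡ true
      close  : adj (c (fromℕ (suc (suc k)))) (c zero) ≡ true

  Acyclic : Set
  Acyclic = ¬ Cycle

module _ (G : Graph) where
  open Graph G

  IsLeaf : Fin n → Set
  IsLeaf v = deg adj v ≡ 1

  isLeafᵇ : Fin n → Bool
  isLeafᵇ v with deg adj v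
  ... | 1 = true
  ... | _ = false

  numLeaves : ℕ
  numLeaves = countTrue isLeafᵇ

  IsPhyloNetwork : Set
  IsPhyloNetwork = Connected adj × (∃[ v ] IsLeaf v) × (∀ v → deg adj v ≢ 2)

  IsTree : Set
  IsTree = Connected adj × Acyclic adj

  record SpanningForest : Set where
    field
      f       : Fin n → Fin n → Bool
      f-sym   : ∀ u v → f u v ≡ f v u
      f⊆adj   : ∀ u v → f u v ≡ true → adj u v ≡ true
      acyclic : Acyclic f

  -- N is forest-based: there is a spanning forest F whose leaf set is L(N)
  -- (a leaf of a forest is a vertex of degree ≤ 1 in it, so that a
  -- single-vertex tree counts as a leaf), and every edge of N not in F
  -- joins two different connected components of F.
  IsForestBased : Set
  IsForestBased = Σ SpanningForest λ F → let open SpanningForest F in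
      (∀ v → (deg f v ≤ 1) ⇔ IsLeaf v)
    × (∀ u v → adj u v ≡ true → f u v ≡ false → ¬ Walk f u v)

  -- an induced path of G with k+1 vertices p 0, …, p k, meeting L(N)
  -- exactly in its end vertices (for k = 0: the single vertex is a leaf)
  record LeafInducedPath : Set where
    field
      k       : ℕ
      p       : Fin (suc k) → Fin n
      inj     : Injective _≡_ _≡_ p
      induced : ∀ i j → (adj (p i) (p j) ≡ true)
                        ⇔ (toℕ j ≡ suc (toℕ i) ⊎ toℕ i ≡ suc (toℕ j))
      leaves  : ∀ i → IsLeaf (p i) ⇔ (toℕ i ≡ 0 ⊎ toℕ i ≡ k)

  HasTwoPathLIPP : Set
  HasTwoPathLIPP = Σ LeafInducedPath λ P → Σ LeafInducedPath λ Q →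
      let module P = LeafInducedPath P
          module Q = LeafInducedPath Q in
      (∀ v → (∃[ i ] P.p i ≡ v) ⊎ (∃[ j ] Q.p j ≡ v))
    × (∀ i j → P.p i ≢ Q.p j)

{-# OPTIONS --safe #-}
module Submission where

-- In the forest F a walk that never turns back cannot revisit a vertex, and it
-- can only get stuck at a leaf of N, since every other vertex has F-degree at least 2. Extending
-- the two F-edges at a non-leaf w in this way yields a path through w between two distinct leaves.
-- As N is connected but not a tree, some edge uv of N outside F joins two non-leaves; u and v lie
-- in different components of F, which then hold two of the four leaves each. A vertex with three
-- F-neighbours would reach three distinct leaves in its own component, so F has maximum degree 2,
-- the paths through u and v are all of F, and they are induced because every edge of N outside F
-- joins different components.
--
-- Let F consist of the edges of N inside one of the two paths. Along a cycle
-- of F the position on the path would change by ±1 at every step without ever repeating, which is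
-- impossible; an interior path vertex keeps both its path neighbours in F; and F-walks never leave
-- their path.

open import Defs
open import Data.Nat using (ℕ; zero; suc; _+_; _∸_; _≤_; _<_; z≤n; s≤s; z<s; _≤?_; _≟_)
open import Data.Nat.Properties
open import Data.Bool using (Bool; true; false; if_then_else_; _∧_)
import Data.Bool.Properties as Bool
open import Data.Fin using (Fin; zero; suc; toℕ; inject₁; fromℕ; fromℕ<)
open import Data.Fin.Properties
  using (toℕ-injective; toℕ<n; toℕ-inject₁; toℕ-fromℕ; toℕ-fromℕ<; pigeonhole; any?) renaming (_≟_ to _≟ᶠ_)
open import Data.List using ([]; _∷_; length)
open import Data.List.Relation.Unary.All using (All; []; _∷_; zipWith)
import Data.List.Relation.Unary.All.Properties as All
open import Data.List.Relation.Unary.AllPairs using ([]; _∷_)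
open import Data.List.Relation.Unary.Any using (here; there)
open import Data.List.Relation.Unary.Unique.Propositional using (Unique)
open import Data.List.Membership.Propositional using (_∈_)
open import Data.Product using (∃-syntax; _×_; _,_; proj₁; proj₂)
open import Data.Sum using (_⊎_; inj₁; inj₂; [_,_]′)
open import Data.Empty using (⊥; ⊥-elim)
open import Relation.Nullary using (¬_; yes; no; Dec; does; contradiction; _×-dec_; ¬?)
open import Relation.Nullary.Decidable using (dec-true; dec-false; does-⇔)
open import Relation.Unary using (Decidable)
open import Relation.Binary.PropositionalEquality
open import Function using (_∘_; const; case_of_; _⇔_; mk⇔; Equivalence)

remove : ∀ {m} → Fin m → (Fin m → Bool) → Fin m → Bool
remove x b y = if does (y ≟ᶠ x) then false else b y

remove-≢ : ∀ {m} {x y : Fin m} b → y ≢ x → remove x b y ≡ b y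
remove-≢ {x = x} {y} b y≢x rewrite dec-false (y ≟ᶠ x) y≢x = refl

countTrue-remove : ∀ {m} b (x : Fin m) → b x ≡ true → countTrue b ≡ suc (countTrue (remove x b))
countTrue-remove b zero bx rewrite bx = refl
countTrue-remove b (suc x) bx
  rewrite countTrue-remove (λ i → b (suc i)) x bx = +-suc (if b zero then 1 else 0) _

countTrue-remove-false : ∀ {m} b (x : Fin m) → b x ≡ false → countTrue (remove x b) ≡ countTrue b
countTrue-remove-false b zero bx rewrite bx = refl
countTrue-remove-false b (suc x) bx
  rewrite countTrue-remove-false (λ i → b (suc i)) x bx = refl

countTrue≤suc-remove : ∀ {m} b (x : Fin m) → countTrue b ≤ suc (countTrue (remove x b))
countTrue≤suc-remove b x with b x in bx
... | true  = ≤-reflexive (countTrue-remove b x bx)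
... | false = ≤-trans (≤-reflexive (sym (countTrue-remove-false b x bx))) (n≤1+n _)

countTrue-witness : ∀ {m} (b : Fin m → Bool) → 1 ≤ countTrue b → ∃[ x ] b x ≡ true
countTrue-witness {suc m} b 1≤c with b zero in b0
... | true  = zero , b0
... | false with countTrue-witness (λ i → b (suc i)) 1≤c
...   | x , bx = suc x , bx

countTrue-other : ∀ {m} (b : Fin m → Bool) → 2 ≤ countTrue b → ∀ w → ∃[ x ] b x ≡ true × x ≢ w
countTrue-other b 2≤c w with countTrue-witness (remove w b) (≤-pred (≤-trans 2≤c (countTrue≤suc-remove b w)))
... | x , bx with x ≟ᶠ w
...   | yes refl = contradiction bx λ ()
...   | no x≢w   = x , bx , x≢w

unique-length≤countTrue : ∀ {m} (b : Fin m → Bool) {xs} → Unique xs → All (λ x → b x ≡ true) xs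
                        → length xs ≤ countTrue b
unique-length≤countTrue b [] [] = z≤n
unique-length≤countTrue b {x ∷ xs} (x≢xs ∷ uxs) (bx ∷ bxs) rewrite countTrue-remove b x bx =
  s≤s (unique-length≤countTrue (remove x b) uxs (zipWith (λ (x≢y , by) → trans (remove-≢ b (x≢y ∘ sym)) by) (x≢xs , bxs)))

2≤countTrue : ∀ {m} (b : Fin m → Bool) {x y} → b x ≡ true → b y ≡ true → x ≢ y → 2 ≤ countTrue b
2≤countTrue b bx by x≢y = unique-length≤countTrue b ((x≢y ∷ []) ∷ [] ∷ []) (bx ∷ by ∷ [])

countTrue≤1⇒unique : ∀ {m} (b : Fin m → Bool) {x y} → countTrue b ≤ 1 → b x ≡ true → b y ≡ true → x ≡ y
countTrue≤1⇒unique b {x} {y} c≤1 bx by with x ≟ᶠ y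
... | yes x≡y = x≡y
... | no x≢y  = contradiction (≤-trans (2≤countTrue b bx by x≢y) c≤1) λ { (s≤s ()) }

countTrue-mono : ∀ {m} (b b′ : Fin m → Bool) → (∀ x → b x ≡ true → b′ x ≡ true) → countTrue b ≤ countTrue b′
countTrue-mono {zero}  b b′ b⊆b′ = z≤n
countTrue-mono {suc m} b b′ b⊆b′ with b zero in b0 | b′ zero in b′0
... | true  | true  = s≤s (countTrue-mono _ _ (b⊆b′ ∘ suc))
... | true  | false = contradiction (trans (sym (b⊆b′ zero b0)) b′0) λ ()
... | false | true  = ≤-trans (countTrue-mono _ _ (b⊆b′ ∘ suc)) (n≤1+n _)
... | false | false = countTrue-mono _ _ (b⊆b′ ∘ suc)

module _ {m : ℕ} where

  open import Data.List.Membership.DecPropositional (_≟ᶠ_ {m}) using (_∈?_)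

  countTrue≤length⇒∈ : ∀ (b : Fin m → Bool) {xs} → Unique xs → All (λ x → b x ≡ true) xs
                     → countTrue b ≤ length xs → ∀ {x} → b x ≡ true → x ∈ xs
  countTrue≤length⇒∈ b {xs} uxs bxs c≤len {x} bx with x ∈? xs
  ... | yes x∈xs = x∈xs
  ... | no x∉xs  = contradiction
    (≤-trans (unique-length≤countTrue b (All.¬Any⇒All¬ xs x∉xs ∷ uxs) (bx ∷ bxs)) c≤len) (1+n≰n {length xs})

no-three-distinct-in-pair : ∀ {A : Set} {p q x y z : A} → (x ≡ p ⊎ x ≡ q) → (y ≡ p ⊎ y ≡ q) → (z ≡ p ⊎ z ≡ q)
                          → x ≢ y → x ≢ z → y ≢ z → ⊥
no-three-distinct-in-pair (inj₁ refl) (inj₁ refl) _           x≢y _   _   = x≢y refl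
no-three-distinct-in-pair (inj₂ refl) (inj₂ refl) _           x≢y _   _   = x≢y refl
no-three-distinct-in-pair (inj₁ refl) (inj₂ refl) (inj₁ refl) _   x≢z _   = x≢z refl
no-three-distinct-in-pair (inj₁ refl) (inj₂ refl) (inj₂ refl) _   _   y≢z = y≢z refl
no-three-distinct-in-pair (inj₂ refl) (inj₁ refl) (inj₁ refl) _   _   y≢z = y≢z refl
no-three-distinct-in-pair (inj₂ refl) (inj₁ refl) (inj₂ refl) _   x≢z _   = x≢z refl

InjectiveUpTo : ∀ {A : Set} → (ℕ → A) → ℕ → Set
InjectiveUpTo s L = ∀ i j → i ≤ L → j ≤ L → s i ≡ s j → i ≡ j

joinAt : ∀ {A : Set} → ℕ → (ℕ → A) → (ℕ → A) → ℕ → A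
joinAt L s₁ s₂ t = if does (t ≤? L) then s₁ t else s₂ t

joinAt-≤ : ∀ {A : Set} {L t} (s₁ s₂ : ℕ → A) → t ≤ L → joinAt L s₁ s₂ t ≡ s₁ t
joinAt-≤ {L = L} {t} s₁ s₂ t≤L rewrite dec-true (t ≤? L) t≤L = refl

joinAt-> : ∀ {A : Set} {L t} (s₁ s₂ : ℕ → A) → L < t → joinAt L s₁ s₂ t ≡ s₂ t
joinAt-> {L = L} {t} s₁ s₂ L<t rewrite dec-false (t ≤? L) (<⇒≱ L<t) = refl

module _ {n : ℕ} (g : Fin n → Fin n → Bool) where

  _++ʷ_ : ∀ {x y z} → Walk g x y → Walk g y z → Walk g x z
  here       ++ʷ w′ = w′
  step gxy w ++ʷ w′ = step gxy (w ++ʷ w′)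

  snocʷ : ∀ {x y z} → Walk g x y → g y z ≡ true → Walk g x z
  snocʷ w gyz = w ++ʷ step gyz here

  reverseʷ : (∀ u v → g u v ≡ g v u) → ∀ {x y} → Walk g x y → Walk g y x
  reverseʷ g-sym here                 = here
  reverseʷ g-sym (step {u} {v} guv w) = snocʷ (reverseʷ g-sym w) (trans (g-sym v u) guv)

  record CycleSeq : Set where
    field
      d     : ℕ → Fin n
      K     : ℕ
      edge  : ∀ t → t < 2 + K → g (d t) (d (suc t)) ≡ true
      close : g (d (2 + K)) (d 0) ≡ true
      inj   : InjectiveUpTo d (2 + K)

  cycleSeq⇒cycle : CycleSeq → Cycle g
  cycleSeq⇒cycle cs = record
    { k     = K
    ; c     = d ∘ toℕ
    ; inj   = λ {i} {j} → toℕ-injective ∘ inj (toℕ i) (toℕ j) (≤-pred (toℕ<n i)) (≤-pred (toℕ<n j))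
    ; cons  = λ i → subst (λ t → g (d t) (d (suc (toℕ i))) ≡ true) (sym (toℕ-inject₁ i)) (edge (toℕ i) (toℕ<n i))
    ; close = subst (λ t → g (d t) (d 0) ≡ true) (sym (toℕ-fromℕ (2 + K))) close
    }
    where open CycleSeq cs

  private
    clamp : ∀ {m} → ℕ → Fin (suc m)
    clamp {_}     zero    = zero
    clamp {zero}  (suc t) = zero
    clamp {suc m} (suc t) = suc (clamp t)

    toℕ-clamp : ∀ {m} t → t ≤ m → toℕ (clamp {m} t) ≡ t
    toℕ-clamp zero    _         = refl
    toℕ-clamp (suc t) (s≤s t≤m) = cong suc (toℕ-clamp t t≤m)

  cycle⇒cycleSeq : Cycle g → CycleSeq
  cycle⇒cycleSeq cy = record
    { d     = c ∘ clamp
    ; K     = k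
    ; edge  = λ t t<M → subst (λ i → g (c i) (c (clamp (suc t))) ≡ true) (inject₁-clamp t t<M) (cons (clamp t))
    ; close = subst (λ i → g (c i) (c zero) ≡ true)
                    (toℕ-injective (trans (toℕ-fromℕ _) (sym (toℕ-clamp (2 + k) ≤-refl)))) close
    ; inj   = λ i j i≤M j≤M cᵢ≡cⱼ → trans (sym (toℕ-clamp i i≤M)) (trans (cong toℕ (inj cᵢ≡cⱼ)) (toℕ-clamp j j≤M))
    }
    where
      open Cycle cy
      inject₁-clamp : ∀ t → t < 2 + k → inject₁ (clamp {suc k} t) ≡ clamp t
      inject₁-clamp t t<M = toℕ-injective (begin
        toℕ (inject₁ (clamp t))   ≡⟨ toℕ-inject₁ (clamp t) ⟩
        toℕ (clamp {suc k} t)     ≡⟨ toℕ-clamp t (≤-pred t<M) ⟩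
        t                         ≡⟨ toℕ-clamp t (<⇒≤ t<M) ⟨
        toℕ (clamp {2 + k} t)     ∎)
        where open ≡-Reasoning

  module _ (g-sym : ∀ u v → g u v ≡ g v u) where

    cycleSeq-deg≥2 : (cs : CycleSeq) → ∀ t → t ≤ 2 + CycleSeq.K cs → 2 ≤ deg g (CycleSeq.d cs t)
    cycleSeq-deg≥2 cs zero _ =
      2≤countTrue (g (d 0)) (edge 0 z<s) (trans (g-sym _ _) close) (λ d₁≡dM → 1≢M (inj 1 M (s≤s z≤n) ≤-refl d₁≡dM))
      where open CycleSeq cs
            M = 2 + K
            1≢M : 1 ≢ M
            1≢M ()
    cycleSeq-deg≥2 cs (suc t) t<M with m≤n⇒m<n∨m≡n t<M
    ... | inj₁ t+1<M = 2≤countTrue (g (d (suc t))) (trans (g-sym _ _) (edge t (<⇒≤ t+1<M))) (edge (suc t) t+1<M)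
                         (λ dₜ≡dₜ₊₂ → t≢2+t (inj t (2 + t) (≤-trans (n≤1+n t) (<⇒≤ t+1<M)) t+1<M dₜ≡dₜ₊₂))
      where open CycleSeq cs
            t≢2+t : ∀ {t} → t ≢ 2 + t
            t≢2+t ()
    ... | inj₂ refl = 2≤countTrue (g (d (suc t))) (trans (g-sym _ _) (edge t ≤-refl)) close
                         (λ dₜ≡d₀ → suc-K≢0 (inj t 0 (n≤1+n t) z≤n dₜ≡d₀))
      where open CycleSeq cs
            suc-K≢0 : suc K ≢ 0
            suc-K≢0 ()

restrictCycle : ∀ {n} (g h : Fin n → Fin n → Bool) → (∀ u v → g u v ≡ g v u)
              → (∀ x y → g x y ≡ true → 2 ≤ deg g x → 2 ≤ deg g y → h x y ≡ true)
              → Cycle g → Cycle h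
restrictCycle g h g-sym core⊆h cy = cycleSeq⇒cycle h (record
  { d     = d
  ; K     = K
  ; edge  = λ t t<M → core⊆h _ _ (edge t t<M) (deg≥2 t (<⇒≤ t<M)) (deg≥2 (suc t) t<M)
  ; close = core⊆h _ _ close (deg≥2 (2 + K) ≤-refl) (deg≥2 0 z≤n)
  ; inj   = inj
  })
  where
    cs = cycle⇒cycleSeq g cy
    open CycleSeq cs
    deg≥2 = cycleSeq-deg≥2 g g-sym cs

module _ {n : ℕ} (g : Fin n → Fin n → Bool) where

  record NonBacktracking (s : ℕ → Fin n) (L : ℕ) : Set where
    field
      edge   : ∀ t → t < L → g (s t) (s (suc t)) ≡ true
      noBack : ∀ t → 2 + t ≤ L → s t ≢ s (2 + t)

  module _ {s : ℕ → Fin n} where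

    nonBacktracking-init : ∀ {L} → NonBacktracking s (suc L) → NonBacktracking s L
    nonBacktracking-init w = record
      { edge   = λ t t<L → edge t (m<n⇒m<1+n t<L)
      ; noBack = λ t 2+t≤L → noBack t (m≤n⇒m≤1+n 2+t≤L)
      }
      where open NonBacktracking w

    walkTo : ∀ {L} → NonBacktracking s L → ∀ i → i ≤ L → Walk g (s 0) (s i)
    walkTo w zero    _       = here
    walkTo w (suc i) i+1≤L = snocʷ g (walkTo w i (<⇒≤ i+1≤L)) (NonBacktracking.edge w i i+1≤L)

  nonBacktracking-snoc : ∀ {s L z} → NonBacktracking s (suc L) → g (s (suc L)) z ≡ true → z ≢ s L
                       → NonBacktracking (joinAt (suc L) s (λ _ → z)) (2 + L)
  nonBacktracking-snoc {s} {L} {z} w g-last-z z≢prev = record { edge = edge′ ; noBack = noBack′ }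
    where
      open NonBacktracking w
      s′ = joinAt (suc L) s (λ _ → z)
      s′-old : ∀ {t} → t ≤ suc L → s′ t ≡ s t
      s′-old = joinAt-≤ s (λ _ → z)
      s′-new : s′ (2 + L) ≡ z
      s′-new = joinAt-> s (λ _ → z) ≤-refl
      edge′ : ∀ t → t < 2 + L → g (s′ t) (s′ (suc t)) ≡ true
      edge′ t t<2+L with m≤n⇒m<n∨m≡n (≤-pred t<2+L)
      ... | inj₁ t<1+L = subst₂ (λ u v → g u v ≡ true) (sym (s′-old (<⇒≤ t<1+L))) (sym (s′-old t<1+L)) (edge t t<1+L)
      ... | inj₂ refl  = subst₂ (λ u v → g u v ≡ true) (sym (s′-old ≤-refl)) (sym s′-new) g-last-z
      noBack′ : ∀ t → 2 + t ≤ 2 + L → s′ t ≢ s′ (2 + t)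
      noBack′ t 2+t≤2+L with m≤n⇒m<n∨m≡n (≤-pred 2+t≤2+L)
      ... | inj₁ 2+t≤1+L = λ eq → noBack t 2+t≤1+L
                               (trans (sym (s′-old (≤-trans (n≤1+n t) (<⇒≤ 2+t≤1+L)))) (trans eq (s′-old 2+t≤1+L)))
      ... | inj₂ refl    = λ eq → z≢prev (trans (sym s′-new) (trans (sym eq) (s′-old (n≤1+n t))))

  module Glue (g-sym : ∀ u v → g u v ≡ g v u) {s₁ s₂ : ℕ → Fin n} {L₁ L₂ : ℕ}
              (w₁ : NonBacktracking s₁ L₁) (w₂ : NonBacktracking s₂ L₂)
              (same-start : s₁ 0 ≡ s₂ 0) (diverge : s₁ 1 ≢ s₂ 1) where

    private
      module W₁ = NonBacktracking w₁
      module W₂ = NonBacktracking w₂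
      Edge : Fin n → Fin n → Set
      Edge u v = g u v ≡ true

    glued : ℕ → Fin n
    glued = joinAt L₁ (λ t → s₁ (L₁ ∸ t)) (λ t → s₂ (t ∸ L₁))

    private
      glued-≤ : ∀ {t} → t ≤ L₁ → glued t ≡ s₁ (L₁ ∸ t)
      glued-≤ = joinAt-≤ (λ t → s₁ (L₁ ∸ t)) (λ t → s₂ (t ∸ L₁))

      glued-> : ∀ {t} → L₁ < t → glued t ≡ s₂ (t ∸ L₁)
      glued-> = joinAt-> (λ t → s₁ (L₁ ∸ t)) (λ t → s₂ (t ∸ L₁))

    glued-left : ∀ t r → t + r ≡ L₁ → glued t ≡ s₁ r
    glued-left t r t+r≡L₁ = trans (glued-≤ (subst (t ≤_) t+r≡L₁ (m≤m+n t r)))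
                                  (cong s₁ (subst (λ L → L ∸ t ≡ r) t+r≡L₁ (m+n∸m≡n t r)))

    glued-right : ∀ e → glued (L₁ + e) ≡ s₂ e
    glued-right zero    = trans (glued-left (L₁ + 0) 0 (trans (+-identityʳ _) (+-identityʳ L₁))) same-start
    glued-right (suc e) = trans (glued-> (m<m+n L₁ z<s)) (cong s₂ (m+n∸m≡n L₁ (suc e)))

    glued-right-suc : ∀ e → glued (suc (L₁ + e)) ≡ s₂ (suc e)
    glued-right-suc e = trans (cong glued (sym (+-suc L₁ e))) (glued-right (suc e))

    glued-edge : ∀ t → t < L₁ + L₂ → Edge (glued t) (glued (suc t))
    glued-edge t t<L with suc t ≤? L₁
    ... | yes 1+t≤L₁ with m≤n⇒∃[o]m+o≡n 1+t≤L₁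
    ...   | r , 1+t+r≡L₁ = subst₂ Edge (sym (glued-left t (suc r) (trans (+-suc t r) 1+t+r≡L₁)))
                                         (sym (glued-left (suc t) r 1+t+r≡L₁))
                             (trans (g-sym _ _) (W₁.edge r (subst (r <_) 1+t+r≡L₁ (s≤s (m≤n+m r t)))))
    glued-edge t t<L | no 1+t≰L₁ with m≤n⇒∃[o]m+o≡n (≤-pred (≰⇒> 1+t≰L₁))
    ...   | e , refl = subst₂ Edge (sym (glued-right e)) (sym (glued-right-suc e)) (W₂.edge e (+-cancelˡ-< L₁ e L₂ t<L))

    glued-noBack : ∀ t → 2 + t ≤ L₁ + L₂ → glued t ≢ glued (2 + t)
    glued-noBack t 2+t≤L with 2 + t ≤? L₁
    ... | yes 2+t≤L₁ with m≤n⇒∃[o]m+o≡n 2+t≤L₁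
    ...   | r , 2+t+r≡L₁ = λ eq → W₁.noBack r (subst (2 + r ≤_) 2+t+r≡L₁ (s≤s (s≤s (m≤n+m r t))))
                             (trans (sym (glued-left (2 + t) r 2+t+r≡L₁))
                                    (trans (sym eq) (glued-left t (2 + r) (trans (+-suc t (suc r)) (trans (cong suc (+-suc t r)) 2+t+r≡L₁)))))
    glued-noBack t 2+t≤L | no 2+t≰L₁ with m≤n⇒∃[o]m+o≡n (≤-pred (≰⇒> 2+t≰L₁))
    ...   | zero , L₁+0≡1+t =
            λ eq → diverge (trans (sym (glued-left t 1 (trans (+-comm t 1) (sym L₁≡1+t))))
                                  (trans eq (trans (cong (glued ∘ suc) (sym L₁+0≡1+t)) (glued-right-suc 0))))
      where L₁≡1+t : L₁ ≡ suc t
            L₁≡1+t = trans (sym (+-identityʳ L₁)) L₁+0≡1+t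
    ...   | suc e , L₁+1+e≡1+t with trans (sym (+-suc L₁ e)) L₁+1+e≡1+t
    ...     | refl = λ eq → W₂.noBack e (+-cancelˡ-≤ L₁ (2 + e) L₂ (subst (_≤ L₁ + L₂) (sym L₁+2+e≡) 2+t≤L))
                                 (trans (sym (glued-right e)) (trans eq (trans (cong glued (sym L₁+2+e≡)) (glued-right (2 + e)))))
      where L₁+2+e≡ : L₁ + (2 + e) ≡ 2 + (L₁ + e)
            L₁+2+e≡ = trans (+-suc L₁ (suc e)) (cong suc (+-suc L₁ e))

    glued-nonBacktracking : NonBacktracking glued (L₁ + L₂)
    glued-nonBacktracking = record { edge = glued-edge ; noBack = glued-noBack }

  record Extension (Stop : Fin n → Set) (s : ℕ → Fin n) (L : ℕ) : Set where
    field
      s′              : ℕ → Fin n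
      L′              : ℕ
      nonBacktracking : NonBacktracking s′ L′
      prefix          : ∀ {t} → t ≤ L → s′ t ≡ s t
      L≤L′            : L ≤ L′
      stops           : Stop (s′ L′)

  module _ (g-irrefl : ∀ v → g v v ≡ false) (acyclic : Acyclic g) where

    private
      -- s (suc L) = s j would close the loop s j, …, s L, s (suc L): a self-loop, a backtrack or a cycle.
      last-fresh : ∀ {s L} → NonBacktracking s (suc L) → InjectiveUpTo s L → ∀ j → j ≤ L → s j ≢ s (suc L)
      last-fresh {s} w inj j j≤L sⱼ≡last with m≤n⇒∃[o]m+o≡n j≤L
      ... | 0 , refl rewrite +-identityʳ j =
        contradiction (subst (λ v → g (s j) v ≡ true) (sym sⱼ≡last) (edge j ≤-refl)) (λ loop → case trans (sym loop) (g-irrefl _) of λ ())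
        where open NonBacktracking w
      ... | 1 , refl = noBack j (≤-reflexive (cong suc (+-comm 1 j))) (trans sⱼ≡last (cong (s ∘ suc) (+-comm j 1)))
        where open NonBacktracking w
      ... | suc (suc K) , refl = acyclic (cycleSeq⇒cycle g record
        { d     = λ t → s (j + t)
        ; K     = K
        ; edge  = λ t t<M → subst (λ i → g (s (j + t)) (s i) ≡ true) (sym (+-suc j t))
                                   (edge (j + t) (m<n⇒m<1+n (+-monoʳ-< j t<M)))
        ; close = subst (λ v → g (s (j + (2 + K))) v ≡ true) (trans (sym sⱼ≡last) (cong s (sym (+-identityʳ j))))
                        (edge (j + (2 + K)) ≤-refl)
        ; inj   = λ a b a≤M b≤M sa≡sb → +-cancelˡ-≡ j a b (inj (j + a) (j + b) (+-monoʳ-≤ j a≤M) (+-monoʳ-≤ j b≤M) sa≡sb)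
        })
        where open NonBacktracking w

      snoc-injective : ∀ {s L} → NonBacktracking s (suc L) → InjectiveUpTo s L → InjectiveUpTo s (suc L)
      snoc-injective w inj i j i≤ j≤ sᵢ≡sⱼ with m≤n⇒m<n∨m≡n i≤ | m≤n⇒m<n∨m≡n j≤
      ... | inj₁ i≤L  | inj₁ j≤L  = inj i j (≤-pred i≤L) (≤-pred j≤L) sᵢ≡sⱼ
      ... | inj₁ i≤L  | inj₂ refl = ⊥-elim (last-fresh w inj i (≤-pred i≤L) sᵢ≡sⱼ)
      ... | inj₂ refl | inj₁ j≤L  = ⊥-elim (last-fresh w inj j (≤-pred j≤L) (sym sᵢ≡sⱼ))
      ... | inj₂ refl | inj₂ refl = refl

    nonBacktracking-injective : ∀ L {s} → NonBacktracking s L → InjectiveUpTo s L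
    nonBacktracking-injective zero    w zero zero _ _ _ = refl
    nonBacktracking-injective (suc L) w = snoc-injective w (nonBacktracking-injective L (nonBacktracking-init w))

    -- Fuel n suffices: the walk stays injective, so it has at most n vertices.
    extendUntil : {Stop : Fin n → Set} → Decidable Stop → (∀ v → ¬ Stop v → 2 ≤ deg g v)
                → ∀ {s L} → NonBacktracking s (suc L) → Extension Stop s (suc L)
    extendUntil {Stop} stop? branches {L = L} = go n (m≤n+m n (suc L))
      where
        go : ∀ fuel {s L} → n ≤ suc L + fuel → NonBacktracking s (suc L) → Extension Stop s (suc L)
        go zero {s} {L} n≤1+L w with pigeonhole (s≤s (subst (n ≤_) (+-identityʳ (suc L)) n≤1+L)) (s ∘ toℕ)
        ... | i , j , i<j , sᵢ≡sⱼ =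
          contradiction (nonBacktracking-injective (suc L) w (toℕ i) (toℕ j) (≤-pred (toℕ<n i)) (≤-pred (toℕ<n j)) sᵢ≡sⱼ)
                        (<⇒≢ i<j)
        go (suc fuel) {s} {L} n≤ w with stop? (s (suc L))
        ... | yes stop = record
          { s′ = s ; L′ = suc L ; nonBacktracking = w ; prefix = λ _ → refl ; L≤L′ = ≤-refl ; stops = stop }
        ... | no ¬stop with countTrue-other (g (s (suc L))) (branches _ ¬stop) (s L)
        ...   | z , g-last-z , z≢prev = record
          { s′              = s′
          ; L′              = L′
          ; nonBacktracking = nonBacktracking
          ; prefix          = λ t≤1+L → trans (prefix (m≤n⇒m≤1+n t≤1+L)) (joinAt-≤ s (λ _ → z) t≤1+L)
          ; L≤L′            = ≤-trans (n≤1+n _) L≤L′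
          ; stops           = stops
          }
          where open Extension (go fuel (subst (n ≤_) (+-suc (suc L) fuel) n≤) (nonBacktracking-snoc w g-last-z z≢prev))

UnitStep : ℕ → ℕ → Set
UnitStep a b = b ≡ suc a ⊎ a ≡ suc b

module _ (σ : ℕ → ℕ) (M : ℕ) (steps : ∀ t → t < M → UnitStep (σ t) (σ (suc t))) (inj : InjectiveUpTo σ M) where

  private
    t≢2+t : ∀ {t} → t ≢ 2 + t
    t≢2+t ()

    M≢1 : 2 ≤ M → M ≢ 1
    M≢1 2≤M refl = contradiction 2≤M λ { (s≤s ()) }

    -- Since σ (2 + t) ≢ σ t, every step goes the way the first one went.
    ascending-steps : σ 1 ≡ suc (σ 0) → ∀ t → t < M → σ (suc t) ≡ suc (σ t)
    ascending-steps up zero    _     = up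
    ascending-steps up (suc t) 1+t<M with steps (suc t) 1+t<M
    ... | inj₁ σ-up   = σ-up
    ... | inj₂ σ-down = contradiction (inj t (2 + t) (≤-trans (n≤1+n t) (<⇒≤ 1+t<M)) 1+t<M
                          (suc-injective (trans (sym (ascending-steps up t (<⇒≤ 1+t<M))) σ-down))) t≢2+t

    descending-steps : σ 0 ≡ suc (σ 1) → ∀ t → t < M → σ t ≡ suc (σ (suc t))
    descending-steps down zero    _     = down
    descending-steps down (suc t) 1+t<M with steps (suc t) 1+t<M
    ... | inj₂ σ-down = σ-down
    ... | inj₁ σ-up   = contradiction (inj t (2 + t) (≤-trans (n≤1+n t) (<⇒≤ 1+t<M)) 1+t<M
                          (trans (descending-steps down t (<⇒≤ 1+t<M)) (sym σ-up))) t≢2+t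

    ascending : σ 1 ≡ suc (σ 0) → ∀ t → t ≤ M → σ t ≡ σ 0 + t
    ascending up zero    _       = sym (+-identityʳ _)
    ascending up (suc t) 1+t≤M = begin
      σ (suc t)      ≡⟨ ascending-steps up t 1+t≤M ⟩
      suc (σ t)      ≡⟨ cong suc (ascending up t (<⇒≤ 1+t≤M)) ⟩
      suc (σ 0 + t)  ≡⟨ +-suc (σ 0) t ⟨
      σ 0 + suc t    ∎
      where open ≡-Reasoning

    descending : σ 0 ≡ suc (σ 1) → ∀ t → t ≤ M → σ t + t ≡ σ 0
    descending down zero    _       = +-identityʳ _
    descending down (suc t) 1+t≤M = begin
      σ (suc t) + suc t    ≡⟨ +-suc (σ (suc t)) t ⟩
      suc (σ (suc t)) + t  ≡⟨ cong (_+ t) (descending-steps down t 1+t≤M) ⟨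
      σ t + t              ≡⟨ descending down t (<⇒≤ 1+t≤M) ⟩
      σ 0                  ∎
      where open ≡-Reasoning

  no-closed-injective-unitSteps : 2 ≤ M → UnitStep (σ M) (σ 0) → ⊥
  no-closed-injective-unitSteps 2≤M closing with steps 0 (≤-trans (s≤s z≤n) 2≤M) | closing
  ... | inj₁ up   | inj₁ σ₀≡1+σM = contradiction (trans σ₀≡1+σM (cong suc (ascending up M ≤-refl))) (m≢1+m+n (σ 0))
  ... | inj₁ up   | inj₂ σM≡1+σ₀ =
    M≢1 2≤M (+-cancelˡ-≡ (σ 0) M 1 (trans (sym (ascending up M ≤-refl)) (trans σM≡1+σ₀ (+-comm 1 (σ 0)))))
  ... | inj₂ down | inj₁ σ₀≡1+σM =
    M≢1 2≤M (+-cancelˡ-≡ (σ M) M 1 (trans (descending down M ≤-refl) (trans σ₀≡1+σM (+-comm 1 (σ M)))))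
  ... | inj₂ down | inj₂ σM≡1+σ₀ = contradiction (trans (sym (descending down M ≤-refl)) (cong (_+ M) σM≡1+σ₀)) (m≢1+m+n (σ 0))

module _ (N : Graph) where
  open Graph N using (adj)

  isLeaf? : Decidable (IsLeaf N)
  isLeaf? v = deg adj v ≟ 1

  IsLeaf⇒isLeafᵇ : ∀ {v} → IsLeaf N v → isLeafᵇ N v ≡ true
  IsLeaf⇒isLeafᵇ {v} leaf with deg adj v
  IsLeaf⇒isLeafᵇ refl | .1 = refl

  deg≥2⇒¬IsLeaf : ∀ {v} → 2 ≤ deg adj v → ¬ IsLeaf N v
  deg≥2⇒¬IsLeaf 2≤deg leaf = contradiction (subst (2 ≤_) leaf 2≤deg) λ { (s≤s ()) }

module ForestBased⇒TwoPathLIPP (N : Graph) (F : SpanningForest N)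
         (leaf⇔ : ∀ v → (deg (SpanningForest.f F) v ≤ 1) ⇔ IsLeaf N v)
         (separates : ∀ u v → Graph.adj N u v ≡ true → SpanningForest.f F u v ≡ false → ¬ Walk (SpanningForest.f F) u v) where

  open Graph N renaming (sym to adj-sym)
  open SpanningForest F

  f-irrefl : ∀ v → f v v ≡ false
  f-irrefl v with f v v in fvv
  ... | true  = contradiction (trans (sym (f⊆adj v v fvv)) (irrefl v)) λ ()
  ... | false = refl

  private
    _▸_ : ∀ {x y z} → Walk f x y → Walk f y z → Walk f x z
    _▸_ = _++ʷ_ f

    _⁻¹ : ∀ {x y} → Walk f x y → Walk f y x
    _⁻¹ = reverseʷ f f-sym

  ¬IsLeaf⇒branching : ∀ {v} → ¬ IsLeaf N v → 2 ≤ deg f v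
  ¬IsLeaf⇒branching {v} ¬leaf = ≰⇒> (¬leaf ∘ Equivalence.to (leaf⇔ v))

  two-neighbours : ∀ {w} → ¬ IsLeaf N w → ∃[ x ] ∃[ y ] f w x ≡ true × f w y ≡ true × x ≢ y
  two-neighbours ¬leaf with countTrue-witness (f _) (≤-trans (s≤s z≤n) (¬IsLeaf⇒branching ¬leaf))
  ... | x , fwx with countTrue-other (f _) (¬IsLeaf⇒branching ¬leaf) x
  ...   | y , fwy , y≢x = x , y , fwx , fwy , y≢x ∘ sym

  edgeSeq : Fin n → Fin n → ℕ → Fin n
  edgeSeq w x zero    = w
  edgeSeq w x (suc _) = x

  edgeSeq-nonBacktracking : ∀ {w x} → f w x ≡ true → NonBacktracking f (edgeSeq w x) 1
  edgeSeq-nonBacktracking fwx = record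
    { edge   = λ { zero _ → fwx ; (suc _) (s≤s ()) }
    ; noBack = λ { _ (s≤s ()) }
    }

  module Branch {w x : Fin n} (fwx : f w x ≡ true) where
    open Extension (extendUntil f f-irrefl acyclic (isLeaf? N) (λ _ → ¬IsLeaf⇒branching) (edgeSeq-nonBacktracking fwx)) public

    leaf : Fin n
    leaf = s′ L′

    starts : s′ 0 ≡ w
    starts = prefix z≤n

    continues : s′ 1 ≡ x
    continues = prefix ≤-refl

    walk : Walk f w leaf
    walk = subst (λ v → Walk f v leaf) starts (walkTo f nonBacktracking L′ ≤-refl)

  record LeafPath : Set where
    field
      s               : ℕ → Fin n
      L               : ℕ
      nonBacktracking : NonBacktracking f s L
      1≤L             : 1 ≤ L
      leaf₀           : IsLeaf N (s 0)
      leafL           : IsLeaf N (s L)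

    injective : InjectiveUpTo s L
    injective = nonBacktracking-injective f f-irrefl acyclic L nonBacktracking

    walk : ∀ {i j} → i ≤ L → j ≤ L → Walk f (s i) (s j)
    walk i≤L j≤L = (walkTo f nonBacktracking _ i≤L ⁻¹) ▸ walkTo f nonBacktracking _ j≤L

    ends-distinct : s 0 ≢ s L
    ends-distinct s₀≡sL = contradiction (injective 0 L z≤n ≤-refl s₀≡sL) (<⇒≢ 1≤L)

  record LeafPathThrough (w : Fin n) : Set where
    field
      path   : LeafPath
      m      : ℕ
      m≤L    : m ≤ LeafPath.L path
      visits : LeafPath.s path m ≡ w

    open LeafPath path public

    reach : ∀ {i} → i ≤ L → Walk f w (s i)
    reach i≤L = subst (λ x → Walk f x (s _)) visits (walk m≤L i≤L)

  module Through {w x y : Fin n} (fwx : f w x ≡ true) (fwy : f w y ≡ true) (x≢y : x ≢ y) where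
    private
      module B₁ = Branch fwx
      module B₂ = Branch fwy
    open Glue f f-sym B₁.nonBacktracking B₂.nonBacktracking (trans B₁.starts (sym B₂.starts))
              (λ eq → x≢y (trans (sym B₁.continues) (trans eq B₂.continues)))

    path : LeafPath
    path = record
      { s               = glued
      ; L               = B₁.L′ + B₂.L′
      ; nonBacktracking = glued-nonBacktracking
      ; 1≤L             = ≤-trans B₁.L≤L′ (m≤m+n _ _)
      ; leaf₀           = subst (IsLeaf N) (sym (glued-left 0 B₁.L′ refl)) B₁.stops
      ; leafL           = subst (IsLeaf N) (sym (glued-right B₂.L′)) B₂.stops
      }

    branch-leaves-distinct : B₁.leaf ≢ B₂.leaf
    branch-leaves-distinct eq =
      LeafPath.ends-distinct path (trans (glued-left 0 B₁.L′ refl) (trans eq (sym (glued-right B₂.L′))))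

    through : LeafPathThrough w
    through = record
      { path = path ; m = B₁.L′ ; m≤L = m≤m+n _ _
      ; visits = trans (glued-left B₁.L′ 0 (+-identityʳ _)) B₁.starts }

  leafPathThrough : ∀ {w} → ¬ IsLeaf N w → LeafPathThrough w
  leafPathThrough ¬leaf with two-neighbours ¬leaf
  ... | _ , _ , fwx , fwy , x≢y = Through.through fwx fwy x≢y

  reachesLeaf : ∀ x → ∃[ ℓ ] IsLeaf N ℓ × Walk f x ℓ
  reachesLeaf x with isLeaf? N x
  ... | yes leaf = x , leaf , here
  ... | no ¬leaf with two-neighbours ¬leaf
  ...   | _ , _ , fxy , _ = Branch.leaf fxy , Branch.stops fxy , Branch.walk fxy

  leaf-unique-neighbour : ∀ {v x y} → IsLeaf N v → f v x ≡ true → f v y ≡ true → x ≡ y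
  leaf-unique-neighbour {v} leaf = countTrue≤1⇒unique (f v) (Equivalence.from (leaf⇔ v) leaf)

  AtMostTwoNeighbours : Set
  AtMostTwoNeighbours = ∀ {w x y z} → f w x ≡ true → f w y ≡ true → f w z ≡ true → x ≢ y → z ≡ x ⊎ z ≡ y

  module OnLeafPath (R : LeafPath) where
    open LeafPath R

    private
      forward : ∀ {i} → i < L → f (s i) (s (suc i)) ≡ true
      forward = NonBacktracking.edge nonBacktracking _

      backward : ∀ {i} → i < L → f (s (suc i)) (s i) ≡ true
      backward i<L = trans (f-sym _ _) (forward i<L)

      around-distinct : ∀ {i} → 2 + i ≤ L → s i ≢ s (2 + i)
      around-distinct {i} 2+i≤L = NonBacktracking.noBack nonBacktracking i 2+i≤L

    leaf-index : ∀ i → i ≤ L → IsLeaf N (s i) → i ≡ 0 ⊎ i ≡ L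
    leaf-index zero    _       _    = inj₁ refl
    leaf-index (suc i) 1+i≤L leaf with m≤n⇒m<n∨m≡n 1+i≤L
    ... | inj₂ 1+i≡L   = inj₂ 1+i≡L
    ... | inj₁ 2+i≤L = contradiction
      (≤-trans (2≤countTrue (f _) (backward (<⇒≤ 2+i≤L)) (forward 2+i≤L) (around-distinct 2+i≤L))
               (Equivalence.from (leaf⇔ _) leaf))
      λ { (s≤s ()) }

    module _ (atMostTwo : AtMostTwoNeighbours) where

      neighbour : ∀ i → i ≤ L → ∀ {z} → f (s i) z ≡ true → ∃[ j ] j ≤ L × s j ≡ z × UnitStep i j
      neighbour zero _ fz = 1 , 1≤L , leaf-unique-neighbour leaf₀ (forward 1≤L) fz , inj₁ refl
      neighbour (suc i) 1+i≤L fz with m≤n⇒m<n∨m≡n 1+i≤L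
      ... | inj₂ refl  = i , n≤1+n i , leaf-unique-neighbour leafL (backward 1+i≤L) fz , inj₂ refl
      ... | inj₁ 2+i≤L with atMostTwo (backward 1+i≤L) (forward 2+i≤L) fz (around-distinct 2+i≤L)
      ...   | inj₁ z≡sᵢ   = i , ≤-trans (n≤1+n i) 1+i≤L , sym z≡sᵢ , inj₂ refl
      ...   | inj₂ z≡s₂₊ᵢ = 2 + i , 2+i≤L , sym z≡s₂₊ᵢ , inj₁ refl

      closed : ∀ {i x} → i ≤ L → Walk f (s i) x → ∃[ j ] j ≤ L × s j ≡ x
      closed i≤L here = _ , i≤L , refl
      closed i≤L (step fz W) with neighbour _ i≤L fz
      ... | j , j≤L , refl , _ = closed j≤L W

      reachable⇒on-path : ∀ {i x} → i ≤ L → Walk f (s i) x → ∃[ j ] s (toℕ {suc L} j) ≡ x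
      reachable⇒on-path i≤L W with closed i≤L W
      ... | j , j≤L , sⱼ≡x = fromℕ< (s≤s j≤L) , trans (cong s (toℕ-fromℕ< (s≤s j≤L))) sⱼ≡x

      toLeafInducedPath : LeafInducedPath N
      toLeafInducedPath = record
        { k       = L
        ; p       = s ∘ toℕ
        ; inj     = λ {i} {j} → toℕ-injective ∘ injective (toℕ i) (toℕ j) (bound i) (bound j)
        ; induced = λ i j → mk⇔ (adjacent⇒unitStep i j) (unitStep⇒adjacent i j)
        ; leaves  = λ i → mk⇔ (leaf-index (toℕ i) (bound i)) leaf-at-end
        }
        where
          bound : (i : Fin (suc L)) → toℕ i ≤ L
          bound i = ≤-pred (toℕ<n i)

          adjacent⇒unitStep : ∀ i j → adj (s (toℕ i)) (s (toℕ j)) ≡ true → UnitStep (toℕ i) (toℕ j)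
          adjacent⇒unitStep i j adj-ij with f (s (toℕ i)) (s (toℕ j)) in fij
          ... | false = ⊥-elim (separates _ _ adj-ij fij (walk (bound i) (bound j)))
          ... | true with neighbour (toℕ i) (bound i) fij
          ...   | j′ , j′≤L , sⱼ′≡sⱼ , unit-step with injective j′ (toℕ j) j′≤L (bound j) sⱼ′≡sⱼ
          ...     | refl = unit-step

          unitStep⇒adjacent : ∀ i j → UnitStep (toℕ i) (toℕ j) → adj (s (toℕ i)) (s (toℕ j)) ≡ true
          unitStep⇒adjacent i j (inj₁ j≡1+i) rewrite j≡1+i = f⊆adj _ _ (forward (subst (_≤ L) j≡1+i (bound j)))
          unitStep⇒adjacent i j (inj₂ i≡1+j) rewrite i≡1+j = f⊆adj _ _ (backward (subst (_≤ L) i≡1+j (bound i)))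

          leaf-at-end : ∀ {i} → toℕ i ≡ 0 ⊎ toℕ i ≡ L → IsLeaf N (s (toℕ i))
          leaf-at-end (inj₁ i≡0) rewrite i≡0 = leaf₀
          leaf-at-end (inj₂ i≡L) rewrite i≡L = leafL

  Bridge : Fin n → Fin n → Set
  Bridge u v = adj u v ≡ true × f u v ≡ false × ¬ IsLeaf N u × ¬ IsLeaf N v

  bridge? : ∀ u v → Dec (Bridge u v)
  bridge? u v = (adj u v Bool.≟ true) ×-dec (f u v Bool.≟ false) ×-dec ¬? (isLeaf? N u) ×-dec ¬? (isLeaf? N v)

  bridge : Connected adj → ¬ IsTree N → ∃[ u ] ∃[ v ] Bridge u v
  bridge connected not-tree with any? (λ u → any? (bridge? u))
  ... | yes uv = uv
  ... | no ¬uv = contradiction (connected , acyclic ∘ restrictCycle adj f adj-sym core⊆f) not-tree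
    where
      core⊆f : ∀ x y → adj x y ≡ true → 2 ≤ deg adj x → 2 ≤ deg adj y → f x y ≡ true
      core⊆f x y adj-xy 2≤x 2≤y with f x y in fxy
      ... | true  = refl
      ... | false = contradiction (x , y , adj-xy , fxy , deg≥2⇒¬IsLeaf N 2≤x , deg≥2⇒¬IsLeaf N 2≤y) ¬uv

  module Partition (four-leaves : numLeaves N ≡ 4) {u v : Fin n} (u≁v : ¬ Walk f u v)
                   (through-u : LeafPathThrough u) (through-v : LeafPathThrough v) where

    module P = LeafPathThrough through-u
    module Q = LeafPathThrough through-v

    P≢Q : ∀ {i j} → i ≤ P.L → j ≤ Q.L → P.s i ≢ Q.s j
    P≢Q i≤L j≤L eq = u≁v (subst (Walk f u) eq (P.reach i≤L) ▸ (Q.reach j≤L ⁻¹))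

    every-leaf-is-an-end : ∀ {ℓ} → IsLeaf N ℓ → ℓ ∈ P.s 0 ∷ P.s P.L ∷ Q.s 0 ∷ Q.s Q.L ∷ []
    every-leaf-is-an-end leaf = countTrue≤length⇒∈ (isLeafᵇ N) distinct
      (IsLeaf⇒isLeafᵇ N P.leaf₀ ∷ IsLeaf⇒isLeafᵇ N P.leafL ∷ IsLeaf⇒isLeafᵇ N Q.leaf₀ ∷ IsLeaf⇒isLeafᵇ N Q.leafL ∷ [])
      (≤-reflexive four-leaves) (IsLeaf⇒isLeafᵇ N leaf)
      where
        distinct : Unique (P.s 0 ∷ P.s P.L ∷ Q.s 0 ∷ Q.s Q.L ∷ [])
        distinct = (P.ends-distinct ∷ P≢Q z≤n z≤n ∷ P≢Q z≤n ≤-refl ∷ [])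
                 ∷ (P≢Q ≤-refl z≤n ∷ P≢Q ≤-refl ≤-refl ∷ [])
                 ∷ (Q.ends-distinct ∷ [])
                 ∷ [] ∷ []

    leaf-side : ∀ {ℓ} → IsLeaf N ℓ → (Walk f u ℓ × (ℓ ≡ P.s 0 ⊎ ℓ ≡ P.s P.L))
                                    ⊎ (Walk f v ℓ × (ℓ ≡ Q.s 0 ⊎ ℓ ≡ Q.s Q.L))
    leaf-side leaf with every-leaf-is-an-end leaf
    ... | here refl                         = inj₁ (P.reach z≤n    , inj₁ refl)
    ... | there (here refl)                 = inj₁ (P.reach ≤-refl , inj₂ refl)
    ... | there (there (here refl))         = inj₂ (Q.reach z≤n    , inj₁ refl)
    ... | there (there (there (here refl))) = inj₂ (Q.reach ≤-refl , inj₂ refl)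

    side : ∀ x → Walk f u x ⊎ Walk f v x
    side x with reachesLeaf x
    ... | ℓ , leaf , x~ℓ with leaf-side leaf
    ...   | inj₁ (u~ℓ , _) = inj₁ (u~ℓ ▸ (x~ℓ ⁻¹))
    ...   | inj₂ (v~ℓ , _) = inj₂ (v~ℓ ▸ (x~ℓ ⁻¹))

    two-leaves-per-component : ∀ w → ∃[ p ] ∃[ q ] ∀ {ℓ} → IsLeaf N ℓ → Walk f w ℓ → ℓ ≡ p ⊎ ℓ ≡ q
    two-leaves-per-component w with side w
    ... | inj₁ u~w = P.s 0 , P.s P.L , near
      where
        near : ∀ {ℓ} → IsLeaf N ℓ → Walk f w ℓ → ℓ ≡ P.s 0 ⊎ ℓ ≡ P.s P.L
        near leaf w~ℓ with leaf-side leaf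
        ... | inj₁ (_ , end)  = end
        ... | inj₂ (v~ℓ , _) = ⊥-elim (u≁v (u~w ▸ (w~ℓ ▸ (v~ℓ ⁻¹))))
    ... | inj₂ v~w = Q.s 0 , Q.s Q.L , near
      where
        near : ∀ {ℓ} → IsLeaf N ℓ → Walk f w ℓ → ℓ ≡ Q.s 0 ⊎ ℓ ≡ Q.s Q.L
        near leaf w~ℓ with leaf-side leaf
        ... | inj₁ (u~ℓ , _) = ⊥-elim (u≁v (u~ℓ ▸ ((w~ℓ ⁻¹) ▸ (v~w ⁻¹))))
        ... | inj₂ (_ , end)  = end

    atMostTwo : AtMostTwoNeighbours
    atMostTwo {w} {x} {y} {z} fwx fwy fwz x≢y with z ≟ᶠ x | z ≟ᶠ y
    ... | yes z≡x | _       = inj₁ z≡x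
    ... | no _    | yes z≡y = inj₂ z≡y
    ... | no z≢x  | no z≢y  = ⊥-elim (no-three-distinct-in-pair
            (near (Branch.stops fwx) (Branch.walk fwx)) (near (Branch.stops fwy) (Branch.walk fwy)) (near (Branch.stops fwz) (Branch.walk fwz))
            (Through.branch-leaves-distinct fwx fwy x≢y) (Through.branch-leaves-distinct fwx fwz (z≢x ∘ sym))
            (Through.branch-leaves-distinct fwy fwz (z≢y ∘ sym)))
      where near = proj₂ (proj₂ (two-leaves-per-component w))

    twoPathLIPP : HasTwoPathLIPP N
    twoPathLIPP = OnLeafPath.toLeafInducedPath P.path atMostTwo
                , OnLeafPath.toLeafInducedPath Q.path atMostTwo
                , cover
                , λ i j → P≢Q (≤-pred (toℕ<n i)) (≤-pred (toℕ<n j))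
      where
        cover : ∀ x → (∃[ i ] P.s (toℕ i) ≡ x) ⊎ (∃[ j ] Q.s (toℕ j) ≡ x)
        cover x with side x
        ... | inj₁ u~x = inj₁ (OnLeafPath.reachable⇒on-path P.path atMostTwo P.m≤L (subst (λ w → Walk f w x) (sym P.visits) u~x))
        ... | inj₂ v~x = inj₂ (OnLeafPath.reachable⇒on-path Q.path atMostTwo Q.m≤L (subst (λ w → Walk f w x) (sym Q.visits) v~x))

  twoPathLIPP : Connected adj → numLeaves N ≡ 4 → ¬ IsTree N → HasTwoPathLIPP N
  twoPathLIPP connected four-leaves not-tree with bridge connected not-tree
  ... | u , v , adj-uv , ¬fuv , ¬leaf-u , ¬leaf-v =
    Partition.twoPathLIPP four-leaves (separates u v adj-uv ¬fuv) (leafPathThrough ¬leaf-u) (leafPathThrough ¬leaf-v)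

module TwoPathLIPP⇒ForestBased (N : Graph) (P Q : LeafInducedPath N)
         (cover : ∀ v → (∃[ i ] LeafInducedPath.p P i ≡ v) ⊎ (∃[ j ] LeafInducedPath.p Q j ≡ v))
         (disjoint : ∀ i j → LeafInducedPath.p P i ≢ LeafInducedPath.p Q j) where

  open Graph N renaming (sym to adj-sym)
  module P = LeafInducedPath P
  module Q = LeafInducedPath Q

  onP : Fin n → Bool
  onP v = [ const true , const false ]′ (cover v)

  index : Fin n → ℕ
  index v = [ toℕ ∘ proj₁ , toℕ ∘ proj₁ ]′ (cover v)

  onP-P : ∀ i → onP (P.p i) ≡ true × index (P.p i) ≡ toℕ i
  onP-P i with cover (P.p i)
  ... | inj₁ (i′ , pᵢ′≡pᵢ) = refl , cong toℕ (P.inj pᵢ′≡pᵢ)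
  ... | inj₂ (j  , qⱼ≡pᵢ) = contradiction (sym qⱼ≡pᵢ) (disjoint i j)

  onP-Q : ∀ j → onP (Q.p j) ≡ false × index (Q.p j) ≡ toℕ j
  onP-Q j with cover (Q.p j)
  ... | inj₁ (i  , pᵢ≡qⱼ) = contradiction pᵢ≡qⱼ (disjoint i j)
  ... | inj₂ (j′ , qⱼ′≡qⱼ) = refl , cong toℕ (Q.inj qⱼ′≡qⱼ)

  onP-true : ∀ {v} → onP v ≡ true → ∃[ i ] P.p i ≡ v
  onP-true {v} onP-v with cover v
  ... | inj₁ on-P = on-P

  onP-false : ∀ {v} → onP v ≡ false → ∃[ j ] Q.p j ≡ v
  onP-false {v} ¬onP-v with cover v
  ... | inj₂ on-Q = on-Q

  sameSide : Fin n → Fin n → Bool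
  sameSide u v = does (onP u Bool.≟ onP v)

  forest : Fin n → Fin n → Bool
  forest u v = adj u v ∧ sameSide u v

  forest-sym : ∀ u v → forest u v ≡ forest v u
  forest-sym u v = cong₂ _∧_ (adj-sym u v) (does-⇔ (mk⇔ sym sym) (onP u Bool.≟ onP v) (onP v Bool.≟ onP u))

  forest⊆adj : ∀ u v → forest u v ≡ true → adj u v ≡ true
  forest⊆adj u v = Bool.∧-conicalˡ (adj u v) (sameSide u v)

  forest-sameSide : ∀ {u v} → forest u v ≡ true → onP u ≡ onP v
  forest-sameSide {u} {v} fuv with onP u Bool.≟ onP v
  ... | yes same = same
  ... | no _     = contradiction (Bool.∧-conicalʳ (adj u v) false fuv) λ ()

  forest-intro : ∀ {u v} → adj u v ≡ true → onP u ≡ onP v → forest u v ≡ true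
  forest-intro {u} {v} adj-uv same rewrite adj-uv = dec-true (onP u Bool.≟ onP v) same

  walk-sameSide : ∀ {u v} → Walk forest u v → onP u ≡ onP v
  walk-sameSide here          = refl
  walk-sameSide (step fuw W) = trans (forest-sameSide fuw) (walk-sameSide W)

  module OnInducedPath (R : LeafInducedPath N) (side : Bool)
                       (onR : ∀ i → onP (LeafInducedPath.p R i) ≡ side × index (LeafInducedPath.p R i) ≡ toℕ i) where
    open LeafInducedPath R

    private
      index-p : ∀ i → index (p i) ≡ toℕ i
      index-p = proj₂ ∘ onR

    index-step : ∀ {x y} → ∃[ i ] p i ≡ x → ∃[ j ] p j ≡ y → adj x y ≡ true → UnitStep (index x) (index y)
    index-step (i , refl) (j , refl) adj-xy rewrite index-p i | index-p j = Equivalence.to (induced i j) adj-xy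

    index-injective : ∀ {x y} → ∃[ i ] p i ≡ x → ∃[ j ] p j ≡ y → index x ≡ index y → x ≡ y
    index-injective (i , refl) (j , refl) eq rewrite index-p i | index-p j = cong p (toℕ-injective eq)

    no-cycle-on-path : (cs : CycleSeq forest) → (∀ t → t ≤ 2 + CycleSeq.K cs → ∃[ i ] p i ≡ CycleSeq.d cs t) → ⊥
    no-cycle-on-path cs on-R = no-closed-injective-unitSteps (index ∘ d) (2 + K)
      (λ t t<M → index-step (on-R t (<⇒≤ t<M)) (on-R (suc t) t<M) (forest⊆adj _ _ (edge t t<M)))
      (λ i j i≤M j≤M eq → CycleSeq.inj cs i j i≤M j≤M (index-injective (on-R i i≤M) (on-R j j≤M) eq))
      (s≤s (s≤s z≤n))
      (index-step (on-R (2 + K) ≤-refl) (on-R 0 z≤n) (forest⊆adj _ _ close))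
      where open CycleSeq cs

    interior-branching : ∀ i → ¬ IsLeaf N (p i) → 2 ≤ deg forest (p i)
    interior-branching i ¬leaf with toℕ i in i≡
    ... | zero = contradiction (Equivalence.from (leaves i) (inj₁ i≡)) ¬leaf
    ... | suc i′ with suc i′ ≟ k
    ...   | yes 1+i′≡k = contradiction (Equivalence.from (leaves i) (inj₂ (trans i≡ 1+i′≡k))) ¬leaf
    ...   | no 1+i′≢k  = 2≤countTrue (forest (p i)) (link prev prev-step) (link next next-step) (prev≢next ∘ inj)
      where
        1+i′≤k : suc i′ ≤ k
        1+i′≤k = ≤-pred (subst (_≤ suc k) (cong suc i≡) (toℕ<n i))
        prev< : i′ < suc k
        prev< = s≤s (≤-trans (n≤1+n i′) 1+i′≤k)
        next< : 2 + i′ < suc k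
        next< = s≤s (≤∧≢⇒< 1+i′≤k 1+i′≢k)
        prev next : Fin (suc k)
        prev = fromℕ< prev<
        next = fromℕ< next<
        prev-step : UnitStep (toℕ i) (toℕ prev)
        prev-step = inj₂ (trans i≡ (cong suc (sym (toℕ-fromℕ< prev<))))
        next-step : UnitStep (toℕ i) (toℕ next)
        next-step = inj₁ (trans (toℕ-fromℕ< next<) (cong suc (sym i≡)))
        prev≢next : prev ≢ next
        prev≢next eq = i′≢2+i′ (trans (sym (toℕ-fromℕ< prev<)) (trans (cong toℕ eq) (toℕ-fromℕ< next<)))
          where i′≢2+i′ : i′ ≢ 2 + i′
                i′≢2+i′ ()
        link : ∀ j → UnitStep (toℕ i) (toℕ j) → forest (p i) (p j) ≡ true
        link j unit-step = forest-intro (Equivalence.from (induced i j) unit-step) (trans (proj₁ (onR i)) (sym (proj₁ (onR j))))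

  cycleSeq-sameSide : (cs : CycleSeq forest) → ∀ t → t ≤ 2 + CycleSeq.K cs → onP (CycleSeq.d cs t) ≡ onP (CycleSeq.d cs 0)
  cycleSeq-sameSide cs zero    _     = refl
  cycleSeq-sameSide cs (suc t) t<M = trans (sym (forest-sameSide (CycleSeq.edge cs t t<M))) (cycleSeq-sameSide cs t (<⇒≤ t<M))

  forest-acyclic : Acyclic forest
  forest-acyclic cy with cycle⇒cycleSeq forest cy
  ... | cs with onP (CycleSeq.d cs 0) in side₀
  ...   | true  = OnInducedPath.no-cycle-on-path P true  onP-P cs (λ t t≤M → onP-true  (trans (cycleSeq-sameSide cs t t≤M) side₀))
  ...   | false = OnInducedPath.no-cycle-on-path Q false onP-Q cs (λ t t≤M → onP-false (trans (cycleSeq-sameSide cs t t≤M) side₀))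

  forest-leaves : ∀ v → (deg forest v ≤ 1) ⇔ IsLeaf N v
  forest-leaves v = mk⇔ deg≤1⇒leaf leaf⇒deg≤1
    where
      leaf⇒deg≤1 : IsLeaf N v → deg forest v ≤ 1
      leaf⇒deg≤1 leaf = ≤-trans (countTrue-mono (forest v) (adj v) (forest⊆adj v)) (≤-reflexive leaf)
      deg≤1⇒leaf : deg forest v ≤ 1 → IsLeaf N v
      deg≤1⇒leaf deg≤1 with isLeaf? N v
      ... | yes leaf  = leaf
      ... | no ¬leaf = contradiction (≤-trans (branching (cover v)) deg≤1) λ { (s≤s ()) }
        where
          branching : (∃[ i ] P.p i ≡ v) ⊎ (∃[ j ] Q.p j ≡ v) → 2 ≤ deg forest v
          branching (inj₁ (i , refl)) = OnInducedPath.interior-branching P true  onP-P i ¬leaf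
          branching (inj₂ (j , refl)) = OnInducedPath.interior-branching Q false onP-Q j ¬leaf

  forest-separates : ∀ u v → adj u v ≡ true → forest u v ≡ false → ¬ Walk forest u v
  forest-separates u v adj-uv ¬fuv W = contradiction (forest-intro adj-uv (walk-sameSide W)) (λ fuv → case trans (sym fuv) ¬fuv of λ ())

  forestBased : IsForestBased N
  forestBased = record { f = forest ; f-sym = forest-sym ; f⊆adj = forest⊆adj ; acyclic = forest-acyclic }
              , forest-leaves , forest-separates

lemma1 : (N : Graph) → IsPhyloNetwork N → numLeaves N ≡ 4 → ¬ IsTree N
         → IsForestBased N ⇔ HasTwoPathLIPP N
lemma1 N (connected , _ , _) four-leaves not-tree = mk⇔
  (λ (F , leaf⇔ , separates) → ForestBased⇒TwoPathLIPP.twoPathLIPP N F leaf⇔ separates connected four-leaves not-tree)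
  (λ (P , Q , cover , disjoint) → TwoPathLIPP⇒ForestBased.forestBased N P Q cover disjoint)
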